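{- For every $n\ge1$, the map $\sigma\mapsto\sigma'$ is a bijection from $\mathfrak S_n''=\{\sigma\in\mathfrak S_n:\sigma(n)=1\}$ onto $\mathfrak S_n'=\{\sigma\in\mathfrak S_n:\sigma(1)=n\}$ satisfying $\Delta E\sigma=\Delta D\sigma'$ for all $\sigma\in\mathfrak S_n''$.
   Context: $[n]=\{1,\dots,n\}$, $\mathfrak S_n$ the symmetric group on $[n]$, $x_+=\max\{0,x\}$. For $\sigma\in\mathfrak S_n$: $E\sigma(k)=(\sigma(k)-(k-1))_+$; with $\sigma(0)=0$, $D\sigma(k)=(\sigma(\sigma^{ -1}(k)-1)-(k-1))_+$ ($k\in[n]$). $\Delta(x_1,\dots,x_p)=((x_1-1)_+,\dots,(x_{p-1}-1)_+)$. The map $\sigma\mapsto\hat\sigma$: for $k\in[n]$ let $\bar k$ be the maximum of the $\sigma$-orbit of $k$, $q_k=\min\{p\ge0:\sigma^p(k)=\bar k\}$, $\Pi_\sigma(k)=(\bar k,q_k)$; $\hat\sigma$ is the unique permutation with $\Pi_\sigma(\hat\sigma(1)),\dots,\Pi_\sigma(\hat\sigma(n))$ lexicographically increasing. For $\sigma\in\mathfrak S_n''$, let $i=\hat\sigma^{ -1}(n)$ and let $\sigma'$ be the permutation with $(\sigma'(1),\dots,\sigma'(n))=(\hat\sigma(i),\hat\sigma(i+1),\dots,\hat\sigma(n),\hat\sigma(1),\dots,\hat\sigma(i-1))$. -}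

module Defs where

open import Data.Nat using (ℕ; zero; suc; _∸_; _⊔_; _<ᵇ_; _≡ᵇ_; _+_)
open import Data.Nat.DivMod using (_mod_)
open import Data.Fin using (Fin; toℕ; fromℕ; inject₁) renaming (zero to fzero; suc to fsuc)
open import Data.Fin.Permutation using (Permutation′; _⟨$⟩ʳ_; _⟨$⟩ˡ_)
open import Data.List using (List; []; _∷_; map; foldr; upTo; allFin)
open import Data.Nat.ListAction using (sum)
open import Data.Bool using (Bool; true; false; if_then_else_; _∧_; _∨_)

-- Conventions: the element k ∈ [n] is represented by the Fin n value k-1,
-- and positions likewise. A permutation σ ∈ 𝔖_n is a Permutation′ n.

val : ∀ {n} → Fin n → ℕ
val x = suc (toℕ x)

iter : ∀ {n} → (Fin n → Fin n) → ℕ → Fin n → Fin n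
iter f zero x = x
iter f (suc p) x = f (iter f p x)

findFirst : ∀ {A : Set} → (A → Bool) → A → List A → A
findFirst P d [] = d
findFirst P d (x ∷ xs) = if P x then x else findFirst P d xs

orbitMax : ∀ {n} → Permutation′ n → Fin n → ℕ
orbitMax {n} σ k = foldr _⊔_ 0 (map (λ p → val (iter (σ ⟨$⟩ʳ_) p k)) (upTo n))

-- q_k = min {p ≥ 0 : σ^p(k) = k̄}  (searched in 0 ≤ p < n, which suffices)
orbitIdx : ∀ {n} → Permutation′ n → Fin n → ℕ
orbitIdx {n} σ k =
  findFirst (λ p → val (iter (σ ⟨$⟩ʳ_) p k) ≡ᵇ orbitMax σ k) 0 (upTo n)

lexLt : ℕ → ℕ → ℕ → ℕ → Bool
lexLt a₁ a₂ b₁ b₂ = (a₁ <ᵇ b₁) ∨ ((a₁ ≡ᵇ b₁) ∧ (a₂ <ᵇ b₂))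

ΠLt : ∀ {n} → Permutation′ n → Fin n → Fin n → Bool
ΠLt σ j k = lexLt (orbitMax σ j) (orbitIdx σ j) (orbitMax σ k) (orbitIdx σ k)

-- rank of k: number of j with Π_σ(j) <lex Π_σ(k); this is σ̂⁻¹(k) - 1
rank : ∀ {n} → Permutation′ n → Fin n → ℕ
rank {n} σ k = sum (map (λ j → if ΠLt σ j k then 1 else 0) (allFin n))

-- σ̂ : position i ↦ the unique k of rank i-1 (the default is never used,
-- since Π_σ is injective)
hat : ∀ {n} → Permutation′ n → Fin n → Fin n
hat {n} σ i = findFirst (λ k → rank σ k ≡ᵇ toℕ i) i (allFin n)

-- σ' : (σ'(1),…,σ'(n)) = (σ̂(i),…,σ̂(n),σ̂(1),…,σ̂(i-1)) with i = σ̂⁻¹(n),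
-- i.e. σ'(p) = σ̂(((p-1) + (i-1)) mod n + 1)
prime : ∀ {n} → Permutation′ n → Fin n → Fin n
prime {suc m} σ p = hat σ ((toℕ p + rank σ (fromℕ m)) mod (suc m))

E : ∀ {n} → Permutation′ n → List ℕ
E {n} σ = map (λ k → val (σ ⟨$⟩ʳ k) ∸ toℕ k) (allFin n)

-- σ(p-1) for a position p, with σ(0) = 0
valBefore : ∀ {n} → Permutation′ n → Fin n → ℕ
valBefore {suc m} σ fzero = 0
valBefore {suc m} σ (fsuc p) = val (σ ⟨$⟩ʳ inject₁ p)

D : ∀ {n} → Permutation′ n → List ℕ
D {n} σ = map (λ k → valBefore σ (σ ⟨$⟩ˡ k) ∸ toℕ k) (allFin n)

Δ : List ℕ → List ℕ
Δ [] = []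
Δ (x ∷ []) = []
Δ (x ∷ y ∷ xs) = (x ∸ 1) ∷ Δ (y ∷ xs)

S'' : ∀ {m} → Permutation′ (suc m) → Set
S'' {m} σ = σ ⟨$⟩ʳ fromℕ m ≡ fzero
  where open import Relation.Binary.PropositionalEquality using (_≡_)

S' : ∀ {m} → Permutation′ (suc m) → Set
S' {m} σ = σ ⟨$⟩ʳ fzero ≡ fromℕ m
  where open import Relation.Binary.PropositionalEquality using (_≡_)

-- Sorting [n] by Π_σ writes σ̂ as the cycles of σ in increasing order of their maxima, each
-- cycle read backwards from its maximum k̄: k̄, σ⁻¹(k̄), σ⁻²(k̄), … So in σ̂ the letter just
-- before k is σ(k) if k is not a cycle maximum; if it is, that letter is smaller than k and
-- σ(k) ≤ k, so the k-th entries of Δ(Eσ) and Δ(Dσ′) both vanish. For σ(n) = 1 the letter 1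
-- closes the last cycle, so in the rotation σ′, which starts with n, every other letter keeps its
-- cyclic predecessor from σ̂, and the entry of n is the one dropped by Δ. Since 1 is the last
-- letter of σ̂, σ′ determines σ̂, which determines σ. Conversely, cutting any word before its
-- left-to-right maxima and reading the blocks backwards as cycles gives a permutation whose σ̂ is
-- that word.

{-# OPTIONS --safe #-}
module Submission where

open import Defs
open import Data.Bool using (Bool; true; false; T; if_then_else_)
open import Data.Empty using (⊥; ⊥-elim)
open import Data.Fin using (Fin; toℕ; fromℕ; fromℕ<; inject₁; punchOut)
  renaming (zero to fzero; suc to fsuc)
open import Data.Fin.Properties
  using (toℕ-injective; toℕ<n; toℕ-fromℕ<; toℕ-fromℕ; toℕ-inject₁; fromℕ≢inject₁; pigeonhole;
         punchOut-injective; any?)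
  renaming (_≟_ to _≟ᶠ_)
open import Data.Fin.Permutation
  using (Permutation′; _⟨$⟩ʳ_; _⟨$⟩ˡ_; permutation; flip; inverseˡ; inverseʳ)
open import Data.List using (List; []; _∷_; map; foldr; allFin; applyUpTo; tabulate; length)
open import Data.List.Properties using (map-tabulate; length-tabulate)
open import Data.List.Membership.Propositional using (_∈_)
open import Data.List.Membership.Propositional.Properties
  using (∈-allFin; ∈-map⁺; ∈-map⁻; ∈-upTo⁺; ∈-upTo⁻)
open import Data.List.Relation.Unary.Any using (here; there)
open import Data.Nat
  using (ℕ; zero; suc; _+_; _*_; _∸_; _⊔_; _≡ᵇ_; _≤_; _<_; z≤n; s≤s; s≤s⁻¹; z<s; s<s; s<s⁻¹;
         _≤?_; _<?_; pred; _%_; _/_; NonZero; >-nonZero; ≢-nonZero)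
open import Data.Nat.Properties
open import Data.Nat.DivMod
  using (_mod_; m%n<n; m≡m%n+[m/n]*n; %-distribˡ-+; m%n%n≡m%n; [m+kn]%n≡m%n; [m+n]%n≡m%n;
         m<n⇒m%n≡m; m≤n⇒m%n≡m; %-pred-≡0; n%n≡0)
open import Data.Nat.ListAction using (sum)
open import Data.Product using (Σ; ∃; _×_; _,_; proj₁; proj₂)
open import Data.Product.Relation.Binary.Lex.Strict using (×-Lex; ×-decidable; ×-isStrictTotalOrder)
open import Data.Product.Relation.Binary.Pointwise.NonDependent using (Pointwise)
open import Data.Sum using (_⊎_; inj₁; inj₂; [_,_]′)
open import Function.Definitions using (Injective)
open import Level using (0ℓ)
open import Relation.Binary using (Rel; Decidable; IsStrictTotalOrder; tri<; tri≈; tri>)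
open import Relation.Binary.PropositionalEquality
open import Relation.Nullary using (¬_; Dec; yes; no; does)
import Relation.Unary as U

-- Ranking elements of Fin n by an injective key

indicator : ∀ {A : Set} → Dec A → ℕ
indicator a? = if does a? then 1 else 0

indicator-mono : ∀ {A B : Set} → (A → B) → (a? : Dec A) (b? : Dec B) → indicator a? ≤ indicator b?
indicator-mono A⇒B (yes _) (yes _) = ≤-refl
indicator-mono A⇒B (yes a) (no ¬b) = ⊥-elim (¬b (A⇒B a))
indicator-mono A⇒B (no _)  _       = z≤n

indicator-< : ∀ {A B : Set} → ¬ A → B → (a? : Dec A) (b? : Dec B) → indicator a? < indicator b?
indicator-< ¬a b (no _)  (yes _) = s≤s z≤n
indicator-< ¬a b (yes a) _       = ⊥-elim (¬a a)
indicator-< ¬a b _       (no ¬b) = ⊥-elim (¬b b)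

indicator≤1 : ∀ {A : Set} (a? : Dec A) → indicator a? ≤ 1
indicator≤1 (yes _) = ≤-refl
indicator≤1 (no _)  = z≤n

count : ∀ {A : Set} {P : U.Pred A 0ℓ} → U.Decidable P → List A → ℕ
count P? xs = sum (map (λ x → indicator (P? x)) xs)

module _ {A : Set} {P Q : U.Pred A 0ℓ} (P? : U.Decidable P) (Q? : U.Decidable Q) (P⊆Q : P U.⊆ Q) where

  count-mono : ∀ xs → count P? xs ≤ count Q? xs
  count-mono []       = z≤n
  count-mono (x ∷ xs) = +-mono-≤ (indicator-mono P⊆Q (P? x) (Q? x)) (count-mono xs)

  count-mono-< : ∀ {x xs} → x ∈ xs → ¬ P x → Q x → count P? xs < count Q? xs
  count-mono-< {x} {_ ∷ xs} (here refl) ¬px qx =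
    +-mono-<-≤ (indicator-< ¬px qx (P? x) (Q? x)) (count-mono xs)
  count-mono-< {_} {y ∷ _} (there x∈xs) ¬px qx =
    +-mono-≤-< (indicator-mono P⊆Q (P? y) (Q? y)) (count-mono-< x∈xs ¬px qx)

count-≤-length : ∀ {A : Set} {P : U.Pred A 0ℓ} (P? : U.Decidable P) xs → count P? xs ≤ length xs
count-≤-length P? []       = z≤n
count-≤-length P? (x ∷ xs) = +-mono-≤ (indicator≤1 (P? x)) (count-≤-length P? xs)

count-<-length : ∀ {A : Set} {P : U.Pred A 0ℓ} (P? : U.Decidable P) {x xs} →
                 x ∈ xs → ¬ P x → count P? xs < length xs
count-<-length P? {x} {_ ∷ xs} (here refl) ¬px with P? x
... | yes px = ⊥-elim (¬px px)
... | no _   = s≤s (count-≤-length P? xs)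
count-<-length P? {_} {y ∷ _} (there x∈xs) ¬px =
  +-mono-≤-< (indicator≤1 (P? y)) (count-<-length P? x∈xs ¬px)

-- Opaque, since the preimages found by the search matter only through their specifications
-- (and unfolding the search is expensive).
opaque
  injective⇒surjective : ∀ {n} (f : Fin n → Fin n) → Injective _≡_ _≡_ f → ∀ y → ∃ λ x → f x ≡ y
  injective⇒surjective {suc n} f f-inj y with any? (λ x → f x ≟ᶠ y)
  ... | yes hit = hit
  ... | no miss
    with i , j , i<j , eq ← pigeonhole ≤-refl (λ x → punchOut {i = y} {j = f x} (λ y≡fx → miss (x , sym y≡fx)))
    = ⊥-elim (<-irrefl (cong toℕ (f-inj (punchOut-injective {i = y} _ _ eq))) i<j)

  injective⇒permutation : ∀ {n} (f : Fin n → Fin n) → Injective _≡_ _≡_ f → Permutation′ n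
  injective⇒permutation f f-inj =
    permutation f (λ y → proj₁ (injective⇒surjective f f-inj y))
      (λ y → proj₂ (injective⇒surjective f f-inj y))
      (λ x → f-inj (proj₂ (injective⇒surjective f f-inj (f x))))

  injective⇒permutation-apply : ∀ {n} (f : Fin n → Fin n) (f-inj : Injective _≡_ _≡_ f) x →
                                injective⇒permutation f f-inj ⟨$⟩ʳ x ≡ f x
  injective⇒permutation-apply f f-inj x = refl

-- The ranking function ρ is a parameter, together with its defining equation, so that the lemmas
-- apply literally to Defs.rank σ.
module Ranking {K : Set} {_≈_ _≺_ : Rel K 0ℓ} (≺-isSTO : IsStrictTotalOrder _≈_ _≺_)
               (_≺?_ : Decidable _≺_) {n : ℕ} (κ : Fin n → K)
               (κ-injective : ∀ {j k} → κ j ≈ κ k → j ≡ k)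
               (ρ : Fin n → ℕ) (ρ-count : ∀ k → ρ k ≡ count (λ j → κ j ≺? κ k) (allFin n)) where

  open IsStrictTotalOrder ≺-isSTO using (compare; irrefl; module Eq) renaming (trans to ≺-trans)

  rank-< : ∀ k → ρ k < n
  rank-< k = subst₂ _<_ (sym (ρ-count k)) (length-tabulate (λ j → j))
    (count-<-length (λ j → κ j ≺? κ k) (∈-allFin k) (irrefl Eq.refl))

  rank-mono : ∀ {j k} → κ j ≺ κ k → ρ j < ρ k
  rank-mono {j} {k} j≺k = subst₂ _<_ (sym (ρ-count j)) (sym (ρ-count k)) (
    count-mono-< (λ i → κ i ≺? κ j) (λ i → κ i ≺? κ k) (λ i≺j → ≺-trans i≺j j≺k)
      (∈-allFin j) (irrefl Eq.refl) j≺k)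

  rank-cancel : ∀ {j k} → ρ j < ρ k → κ j ≺ κ k
  rank-cancel {j} {k} rj<rk with compare (κ j) (κ k)
  ... | tri< j≺k _ _ = j≺k
  ... | tri≈ _ j≈k _ = ⊥-elim (<-irrefl (cong ρ (κ-injective j≈k)) rj<rk)
  ... | tri> _ _ k≺j = ⊥-elim (<-asym rj<rk (rank-mono k≺j))

  rank-injective : ∀ {j k} → ρ j ≡ ρ k → j ≡ k
  rank-injective {j} {k} rj≡rk with compare (κ j) (κ k)
  ... | tri< j≺k _ _ = ⊥-elim (<-irrefl rj≡rk (rank-mono j≺k))
  ... | tri≈ _ j≈k _ = κ-injective j≈k
  ... | tri> _ _ k≺j = ⊥-elim (<-irrefl (sym rj≡rk) (rank-mono k≺j))

  private
    rankᶠ : Fin n → Fin n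
    rankᶠ k = fromℕ< (rank-< k)

    rankᶠ-injective : Injective _≡_ _≡_ rankᶠ
    rankᶠ-injective {j} {k} eq = rank-injective
      (trans (sym (toℕ-fromℕ< (rank-< j))) (trans (cong toℕ eq) (toℕ-fromℕ< (rank-< k))))

  rank-surjective : ∀ {i} → i < n → ∃ λ k → ρ k ≡ i
  rank-surjective {i} i<n with k , eq ← injective⇒surjective rankᶠ rankᶠ-injective (fromℕ< i<n) =
    k , trans (sym (toℕ-fromℕ< (rank-< k))) (trans (cong toℕ eq) (toℕ-fromℕ< i<n))

  rank-cover : ∀ {j k} → κ j ≺ κ k → (∀ x → κ j ≺ κ x → ¬ κ x ≺ κ k) → ρ k ≡ suc (ρ j)
  rank-cover {j} {k} j≺k nothing-between with <-cmp (ρ k) (suc (ρ j))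
  ... | tri< rk<1+rj _ _ = ⊥-elim (<⇒≱ (rank-mono j≺k) (≤-pred rk<1+rj))
  ... | tri≈ _ eq _      = eq
  ... | tri> _ _ 1+rj<rk with x , rx≡1+rj ← rank-surjective (<-trans 1+rj<rk (rank-< k)) =
    ⊥-elim (nothing-between x (rank-cancel (subst (ρ j <_) (sym rx≡1+rj) ≤-refl))
                              (rank-cancel (subst (_< ρ k) (sym rx≡1+rj) 1+rj<rk)))

  rank-maximum : ∀ {k} → (∀ x → ¬ κ k ≺ κ x) → suc (ρ k) ≡ n
  rank-maximum {k} k-maximal with m≤n⇒m<n∨m≡n (rank-< k)
  ... | inj₂ eq = eq
  ... | inj₁ 1+rk<n with x , rx≡1+rk ← rank-surjective 1+rk<n =
    ⊥-elim (k-maximal x (rank-cancel (subst (ρ k <_) (sym rx≡1+rk) ≤-refl)))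

findFirst-satisfies : ∀ {A : Set} (P : A → Bool) (d : A) {x xs} →
                      x ∈ xs → T (P x) → T (P (findFirst P d xs))
findFirst-satisfies P d {x} {y ∷ ys} x∈ px with P y in py | x∈
... | true  | _          = subst T (sym py) _
... | false | here refl  = ⊥-elim (subst T py px)
... | false | there x∈ys = findFirst-satisfies P d x∈ys px

findFirst-applyUpTo : ∀ {A : Set} {P : U.Pred A 0ℓ} (P? : U.Decidable P) (d : A) (g : ℕ → A) {n p} →
  p < n → P (g p) →
  ∃ λ r → r < n × findFirst (λ y → does (P? y)) d (applyUpTo g n) ≡ g r ×
          P (g r) × (∀ {j} → j < r → ¬ P (g j))
findFirst-applyUpTo P? d g {suc n} {p} p<n pgp with P? (g 0) | p
... | yes pg0 | _     = 0 , z<s , refl , pg0 , λ ()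
... | no ¬pg0 | zero  = ⊥-elim (¬pg0 pgp)
... | no ¬pg0 | suc p
  with r , r<n , eq , pgr , below ← findFirst-applyUpTo P? d (λ i → g (suc i)) (s<s⁻¹ p<n) pgp =
  suc r , s<s r<n , eq , pgr , λ { {zero} _ → ¬pg0 ; {suc j} j<r → below (s<s⁻¹ j<r) }

least-unique : ∀ {P : U.Pred ℕ 0ℓ} {r s} → P r → (∀ {j} → j < r → ¬ P j) →
               P s → (∀ {j} → j < s → ¬ P j) → r ≡ s
least-unique {r = r} {s} pr r-least ps s-least with <-cmp r s
... | tri< r<s _ _ = ⊥-elim (s-least r<s pr)
... | tri≈ _ r≡s _ = r≡s
... | tri> _ _ s<r = ⊥-elim (r-least s<r ps)

foldr-⊔-upper : ∀ {x xs} → x ∈ xs → x ≤ foldr _⊔_ 0 xs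
foldr-⊔-upper {xs = y ∷ ys} (here refl)  = m≤m⊔n y _
foldr-⊔-upper {xs = y ∷ ys} (there x∈ys) = ≤-trans (foldr-⊔-upper x∈ys) (m≤n⊔m y _)

foldr-⊔-∈ : ∀ {x xs} → x ∈ xs → foldr _⊔_ 0 xs ∈ xs
foldr-⊔-∈ {xs = y ∷ []} _ = here (⊔-identityʳ y)
foldr-⊔-∈ {xs = y ∷ z ∷ zs} _ =
  [ here , (λ eq → there (subst (_∈ z ∷ zs) (sym eq) (foldr-⊔-∈ (here refl)))) ]′ (⊔-sel y _)

module _ {n : ℕ} (f : Fin n → Fin n) where

  iter-+ : ∀ a b x → iter f (a + b) x ≡ iter f a (iter f b x)
  iter-+ zero    b x = refl
  iter-+ (suc a) b x = cong f (iter-+ a b x)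

  iter-sucʳ : ∀ p x → iter f (suc p) x ≡ iter f p (f x)
  iter-sucʳ zero    x = refl
  iter-sucʳ (suc p) x = cong f (iter-sucʳ p x)

  iter-* : ∀ {d x} → iter f d x ≡ x → ∀ q → iter f (q * d) x ≡ x
  iter-* fix zero    = refl
  iter-* {d} {x} fix (suc q) = trans (iter-+ d (q * d) x) (trans (cong (iter f d) (iter-* fix q)) fix)

  module _ (f-injective : Injective _≡_ _≡_ f) where

    iter-injective : ∀ p {x y} → iter f p x ≡ iter f p y → x ≡ y
    iter-injective zero    eq = eq
    iter-injective (suc p) eq = iter-injective p (f-injective eq)

    iter-period : ∀ x → ∃ λ d → 0 < d × d ≤ n × iter f d x ≡ x
    iter-period x with pigeonhole ≤-refl (λ (i : Fin (suc n)) → iter f (toℕ i) x)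
    ... | i , j , i<j , eq =
      toℕ j ∸ toℕ i , m<n⇒0<n∸m i<j , ≤-trans (m∸n≤m (toℕ j) (toℕ i)) (s≤s⁻¹ (toℕ<n j)) ,
      iter-injective (toℕ i) (begin
        iter f (toℕ i) (iter f (toℕ j ∸ toℕ i) x) ≡⟨ iter-+ (toℕ i) _ x ⟨
        iter f (toℕ i + (toℕ j ∸ toℕ i)) x        ≡⟨ cong (λ e → iter f e x) (m+[n∸m]≡n (<⇒≤ i<j)) ⟩
        iter f (toℕ j) x                          ≡⟨ eq ⟨
        iter f (toℕ i) x                          ∎)
      where open ≡-Reasoning

    iter-reduce : ∀ p x → ∃ λ p′ → p′ < n × iter f p x ≡ iter f p′ x
    iter-reduce p x with d , 0<d , d≤n , return ← iter-period x =
      p % d , <-≤-trans (m%n<n p d) d≤n , (begin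
        iter f p x                              ≡⟨ cong (λ e → iter f e x) (m≡m%n+[m/n]*n p d) ⟩
        iter f (p % d + p / d * d) x            ≡⟨ iter-+ (p % d) _ x ⟩
        iter f (p % d) (iter f (p / d * d) x)   ≡⟨ cong (iter f (p % d)) (iter-* return (p / d)) ⟩
        iter f (p % d) x                        ∎)
      where
        open ≡-Reasoning
        instance _ = >-nonZero 0<d

    iter-of-image : ∀ p x → ∃ λ p′ → iter f p x ≡ iter f p′ (f x)
    iter-of-image p x with suc d , _ , _ , return ← iter-period x =
      p + d , (begin
        iter f p x                  ≡⟨ cong (iter f p) return ⟨
        iter f p (iter f (suc d) x) ≡⟨ iter-+ p (suc d) x ⟨
        iter f (p + suc d) x        ≡⟨ cong (λ e → iter f e x) (+-suc p d) ⟩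
        iter f (suc (p + d)) x      ≡⟨ iter-sucʳ (p + d) x ⟩
        iter f (p + d) (f x)        ∎)
      where open ≡-Reasoning

-- Orbit maxima of a permutation and the order Π_σ

_<ₗₑₓ_ : Rel (ℕ × ℕ) 0ℓ
_<ₗₑₓ_ = ×-Lex _≡_ _<_ _<_

_<ₗₑₓ?_ : Decidable _<ₗₑₓ_
_<ₗₑₓ?_ = ×-decidable _≟_ _<?_ _<?_

<ₗₑₓ-isStrictTotalOrder : IsStrictTotalOrder (Pointwise _≡_ _≡_) _<ₗₑₓ_
<ₗₑₓ-isStrictTotalOrder = ×-isStrictTotalOrder <-isStrictTotalOrder <-isStrictTotalOrder

<ₗₑₓ⇒≤₁ : ∀ {a b c d} → (a , b) <ₗₑₓ (c , d) → a ≤ c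
<ₗₑₓ⇒≤₁ (inj₁ a<c)        = <⇒≤ a<c
<ₗₑₓ⇒≤₁ (inj₂ (refl , _)) = ≤-refl

<ₗₑₓ-no-between : ∀ {a q b r} → (a , q) <ₗₑₓ (b , r) → (b , r) <ₗₑₓ (a , suc q) → ⊥
<ₗₑₓ-no-between (inj₁ a<b)          (inj₁ b<a)         = <-asym a<b b<a
<ₗₑₓ-no-between (inj₁ a<b)          (inj₂ (refl , _))  = <-irrefl refl a<b
<ₗₑₓ-no-between (inj₂ (refl , _))   (inj₁ b<a)         = <-irrefl refl b<a
<ₗₑₓ-no-between (inj₂ (refl , q<r)) (inj₂ (_ , r<1+q)) = <⇒≱ q<r (s≤s⁻¹ r<1+q)

val-injective : ∀ {n} {x y : Fin n} → val x ≡ val y → x ≡ y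
val-injective eq = toℕ-injective (suc-injective eq)

module Orbit {n : ℕ} (σ : Permutation′ n) where

  σ-injective : Injective _≡_ _≡_ (σ ⟨$⟩ʳ_)
  σ-injective eq = trans (sym (inverseˡ σ)) (trans (cong (σ ⟨$⟩ˡ_) eq) (inverseˡ σ))

  σ^ : ℕ → Fin n → Fin n
  σ^ = iter (σ ⟨$⟩ʳ_)

  M : Fin n → ℕ
  M = orbitMax σ

  Q : Fin n → ℕ
  Q = orbitIdx σ

  M-upper : ∀ p k → val (σ^ p k) ≤ M k
  M-upper p k with p′ , p′<n , eq ← iter-reduce (σ ⟨$⟩ʳ_) σ-injective p k =
    subst (_≤ M k) (cong val (sym eq)) (foldr-⊔-upper (∈-map⁺ (λ q → val (σ^ q k)) (∈-upTo⁺ p′<n)))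

  M-attained : ∀ k → ∃ λ p → p < n × val (σ^ p k) ≡ M k
  M-attained k
    with p , p∈ , eq ← ∈-map⁻ (λ q → val (σ^ q k))
                         (foldr-⊔-∈ (∈-map⁺ (λ q → val (σ^ q k)) (∈-upTo⁺ (≤-<-trans z≤n (toℕ<n k)))))
    = p , ∈-upTo⁻ p∈ , sym eq

  M-unique : ∀ {k v} → (∀ p → val (σ^ p k) ≤ v) → ∀ p → val (σ^ p k) ≡ v → M k ≡ v
  M-unique {k} {v} bound p eq with p₀ , _ , eq₀ ← M-attained k =
    ≤-antisym (subst (_≤ v) eq₀ (bound p₀)) (subst (_≤ M k) eq (M-upper p k))

  M-step : ∀ k → M (σ ⟨$⟩ʳ k) ≡ M k
  M-step k with M-attained k
  ... | p , _ , eq with iter-of-image (σ ⟨$⟩ʳ_) σ-injective p k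
  ...   | p′ , p≈p′ = M-unique upper p′ (trans (cong val (sym p≈p′)) eq)
    where
      upper : ∀ q → val (σ^ q (σ ⟨$⟩ʳ k)) ≤ M k
      upper q = subst (_≤ M k) (cong val (iter-sucʳ (σ ⟨$⟩ʳ_) q k)) (M-upper (suc q) k)

  M-iter : ∀ p k → M (σ^ p k) ≡ M k
  M-iter zero    k = refl
  M-iter (suc p) k = trans (M-step (σ^ p k)) (M-iter p k)

  val≤M : ∀ k → val k ≤ M k
  val≤M = M-upper 0

  M≤n : ∀ k → M k ≤ n
  M≤n k with p , _ , eq ← M-attained k = subst (_≤ n) eq (toℕ<n (σ^ p k))

  IsFirstMax : Fin n → ℕ → Set
  IsFirstMax k q = val (σ^ q k) ≡ M k × (∀ {j} → j < q → val (σ^ j k) ≢ M k)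

  Q-spec : ∀ k → IsFirstMax k (Q k)
  Q-spec k with M-attained k
  ... | p , p<n , eq with findFirst-applyUpTo (λ q → val (σ^ q k) ≟ M k) 0 (λ q → q) p<n eq
  ...   | r , _ , Qk≡r , hit , below = subst (IsFirstMax k) (sym Qk≡r) (hit , below)

  Q-unique : ∀ {k r} → IsFirstMax k r → Q k ≡ r
  Q-unique {k} (hit , below) = least-unique (proj₁ (Q-spec k)) (proj₂ (Q-spec k)) hit below

  Q-of-max : ∀ {k} → val k ≡ M k → Q k ≡ 0
  Q-of-max k-max = Q-unique (k-max , λ ())

  max-of-Q : ∀ {k} → Q k ≡ 0 → val k ≡ M k
  max-of-Q {k} Qk≡0 = subst (λ q → val (σ^ q k) ≡ M k) Qk≡0 (proj₁ (Q-spec k))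

  Q-step : ∀ {k q} → Q k ≡ suc q → Q (σ ⟨$⟩ʳ k) ≡ q
  Q-step {k} {q} Qk≡1+q = Q-unique (hit , below)
    where
      one-later : ∀ j → val (σ^ j (σ ⟨$⟩ʳ k)) ≡ val (σ^ (suc j) k)
      one-later j = cong val (sym (iter-sucʳ (σ ⟨$⟩ʳ_) j k))
      hit : val (σ^ q (σ ⟨$⟩ʳ k)) ≡ M (σ ⟨$⟩ʳ k)
      hit = trans (one-later q)
        (trans (subst (λ r → val (σ^ r k) ≡ M k) Qk≡1+q (proj₁ (Q-spec k))) (sym (M-step k)))
      below : ∀ {j} → j < q → val (σ^ j (σ ⟨$⟩ʳ k)) ≢ M (σ ⟨$⟩ʳ k)
      below {j} j<q eq = proj₂ (Q-spec k) (subst (suc j <_) (sym Qk≡1+q) (s<s j<q))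
                           (trans (sym (one-later j)) (trans eq (M-step k)))

  reaches-max : ∀ {k y} → val k ≡ M k → M y ≡ M k → σ^ (Q y) y ≡ k
  reaches-max {k} {y} k-max My≡Mk = val-injective (trans (proj₁ (Q-spec y)) (trans My≡Mk (sym k-max)))

  -- k comes back to itself after Q (σ k) + 1 steps, so no y of its orbit needs more steps to reach k.
  Q-≤-of-max : ∀ {k y} → val k ≡ M k → M y ≡ M k → Q y ≤ Q (σ ⟨$⟩ʳ k)
  Q-≤-of-max {k} {y} k-max My≡Mk with ≤-<-connex (Q y) (Q (σ ⟨$⟩ʳ k))
  ... | inj₁ Qy≤ = Qy≤
  ... | inj₂ Qσk<Qy =
    ⊥-elim (proj₂ (Q-spec y) c<Qy (trans (cong val returns-early) (trans k-max (sym My≡Mk))))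
    where
      qσ = Q (σ ⟨$⟩ʳ k)
      c = Q y ∸ suc qσ
      Qy≡ : suc qσ + c ≡ Q y
      Qy≡ = m+[n∸m]≡n Qσk<Qy
      c<Qy : c < Q y
      c<Qy = subst (c <_) Qy≡ (s≤s (m≤n+m c qσ))
      returns-early : σ^ c y ≡ k
      returns-early = iter-injective (σ ⟨$⟩ʳ_) σ-injective (suc qσ) (begin
        σ^ (suc qσ) (σ^ c y)   ≡⟨ iter-+ (σ ⟨$⟩ʳ_) (suc qσ) c y ⟨
        σ^ (suc qσ + c) y      ≡⟨ cong (λ e → σ^ e y) Qy≡ ⟩
        σ^ (Q y) y             ≡⟨ reaches-max k-max My≡Mk ⟩
        k                      ≡⟨ reaches-max k-max (M-step k) ⟨
        σ^ qσ (σ ⟨$⟩ʳ k)       ≡⟨ iter-sucʳ (σ ⟨$⟩ʳ_) qσ k ⟨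
        σ^ (suc qσ) k          ∎)
        where open ≡-Reasoning

  Π : Fin n → ℕ × ℕ
  Π k = M k , Q k

  Π-injective : ∀ {j k} → Pointwise _≡_ _≡_ (Π j) (Π k) → j ≡ k
  Π-injective {j} {k} (Mj≡Mk , Qj≡Qk) =
    iter-injective (σ ⟨$⟩ʳ_) σ-injective (Q k) (val-injective (begin
      val (σ^ (Q k) j) ≡⟨ cong (λ q → val (σ^ q j)) Qj≡Qk ⟨
      val (σ^ (Q j) j) ≡⟨ proj₁ (Q-spec j) ⟩
      M j              ≡⟨ Mj≡Mk ⟩
      M k              ≡⟨ proj₁ (Q-spec k) ⟨
      val (σ^ (Q k) k) ∎))
    where open ≡-Reasoning

  open Ranking <ₗₑₓ-isStrictTotalOrder _<ₗₑₓ?_ Π Π-injective (rank σ) (λ _ → refl) public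

  rank-step-below-max : ∀ {k q} → Q k ≡ suc q → rank σ k ≡ suc (rank σ (σ ⟨$⟩ʳ k))
  rank-step-below-max {k} {q} Qk≡1+q = rank-cover σk≺k nothing-between
    where
      Qσk≡q : Q (σ ⟨$⟩ʳ k) ≡ q
      Qσk≡q = Q-step Qk≡1+q
      σk≺k : Π (σ ⟨$⟩ʳ k) <ₗₑₓ Π k
      σk≺k = inj₂ (M-step k , subst₂ _<_ (sym Qσk≡q) (sym Qk≡1+q) ≤-refl)
      nothing-between : ∀ x → Π (σ ⟨$⟩ʳ k) <ₗₑₓ Π x → ¬ Π x <ₗₑₓ Π k
      nothing-between x σk≺x x≺k = <ₗₑₓ-no-between
        (subst₂ (λ a b → (a , b) <ₗₑₓ Π x) (M-step k) Qσk≡q σk≺x)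
        (subst (λ b → Π x <ₗₑₓ (M k , b)) Qk≡1+q x≺k)

  rank-step : ∀ {k} → val k ≢ M k → rank σ k ≡ suc (rank σ (σ ⟨$⟩ʳ k))
  rank-step {k} not-max =
    rank-step-below-max (sym (suc-pred (Q k) {{≢-nonZero (λ Qk≡0 → not-max (max-of-Q Qk≡0))}}))

  rank-≤-of-max : ∀ {k y} → val k ≡ M k → M y ≡ M k → rank σ y ≤ rank σ (σ ⟨$⟩ʳ k)
  rank-≤-of-max {k} {y} k-max My≡Mk = ≮⇒≥ (λ σk<y → σk⊀y (rank-cancel σk<y))
    where
      σk⊀y : ¬ Π (σ ⟨$⟩ʳ k) <ₗₑₓ Π y
      σk⊀y (inj₁ Mσk<My)       = <-irrefl (trans (M-step k) (sym My≡Mk)) Mσk<My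
      σk⊀y (inj₂ (_ , Qσk<Qy)) = <⇒≱ Qσk<Qy (Q-≤-of-max k-max My≡Mk)

  val-≤-M-of-rank : ∀ {j k} → rank σ j ≤ rank σ k → val j ≤ M k
  val-≤-M-of-rank {j} {k} rj≤rk with m≤n⇒m<n∨m≡n rj≤rk
  ... | inj₁ rj<rk = ≤-trans (val≤M j) (<ₗₑₓ⇒≤₁ (rank-cancel rj<rk))
  ... | inj₂ rj≡rk = subst (λ x → val x ≤ M k) (sym (rank-injective rj≡rk)) (val≤M k)

  M-witness : ∀ k → ∃ λ x → rank σ x ≤ rank σ k × val x ≡ M k
  M-witness k = x , ≮⇒≥ k⊀x-by-rank , proj₁ (Q-spec k)
    where
      x = σ^ (Q k) k
      Qx≡0 : Q x ≡ 0
      Qx≡0 = Q-of-max (trans (proj₁ (Q-spec k)) (sym (M-iter (Q k) k)))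
      k⊀x-by-rank : ¬ rank σ k < rank σ x
      k⊀x-by-rank rk<rx with rank-cancel rk<rx
      ... | inj₁ Mk<Mx        = <-irrefl (sym (M-iter (Q k) k)) Mk<Mx
      ... | inj₂ (_ , Qk<Qx) = <⇒≱ Qk<Qx (subst (_≤ Q k) (sym Qx≡0) z≤n)

  hat-rank : ∀ i → rank σ (hat σ i) ≡ toℕ i
  hat-rank i = found (rank-surjective (toℕ<n i))
    where
      found : (∃ λ k → rank σ k ≡ toℕ i) → rank σ (hat σ i) ≡ toℕ i
      found (k , rk≡i) = ≡ᵇ⇒≡ (rank σ (hat σ i)) (toℕ i)
        (findFirst-satisfies (λ k → rank σ k ≡ᵇ toℕ i) i (∈-allFin k) (≡⇒≡ᵇ (rank σ k) (toℕ i) rk≡i))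

  hat-unique : ∀ {k i} → rank σ k ≡ toℕ i → hat σ i ≡ k
  hat-unique {k} {i} rk≡i = rank-injective (trans (hat-rank i) (sym rk≡i))

m≤1+n⇒m∸n∸1≡0 : ∀ {a b} → a ≤ suc b → a ∸ b ∸ 1 ≡ 0
m≤1+n⇒m∸n∸1≡0 {a} {b} a≤1+b = trans (pred[m∸n]≡m∸[1+n] a b) (m≤n⇒m∸n≡0 a≤1+b)

toℕ-mod : ∀ a n .{{_ : NonZero n}} → toℕ (a mod n) ≡ a % n
toℕ-mod a n = toℕ-fromℕ< (m%n<n a n)

m<n∸o⇒o<n∸m : ∀ {m n o} → m < n ∸ o → o ≤ n → o < n ∸ m
m<n∸o⇒o<n∸m {m} {n} {o} m<n∸o o≤n = subst (_< n ∸ m) (m∸[m∸n]≡n o≤n) (∸-monoʳ-< m<n∸o (m∸n≤m n o))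

module _ (n : ℕ) .{{_ : NonZero n}} where

  [m%n+o]%n≡[m+o]%n : ∀ a c → (a % n + c) % n ≡ (a + c) % n
  [m%n+o]%n≡[m+o]%n a c = begin
    (a % n + c) % n         ≡⟨ %-distribˡ-+ (a % n) c n ⟩
    (a % n % n + c % n) % n ≡⟨ cong (λ x → (x + c % n) % n) (m%n%n≡m%n a n) ⟩
    (a % n + c % n) % n     ≡⟨ %-distribˡ-+ a c n ⟨
    (a + c) % n             ∎
    where open ≡-Reasoning

  [a+c]%n≡[b+c]%n⇒a≡b : ∀ {a b} c → a < n → b < n → (a + c) % n ≡ (b + c) % n → a ≡ b
  [a+c]%n≡[b+c]%n⇒a≡b {a} {b} c a<n b<n eq = begin
    a                         ≡⟨ undo a<n ⟨
    ((a + c) % n + c′) % n    ≡⟨ cong (λ x → (x + c′) % n) eq ⟩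
    ((b + c) % n + c′) % n    ≡⟨ undo b<n ⟩
    b                         ∎
    where
      open ≡-Reasoning
      c′ = c * pred n
      c+c′≡c*n : c + c′ ≡ c * n
      c+c′≡c*n = trans (sym (*-suc c (pred n))) (cong (c *_) (suc-pred n))
      undo : ∀ {x} → x < n → ((x + c) % n + c′) % n ≡ x
      undo {x} x<n = begin
        ((x + c) % n + c′) % n  ≡⟨ [m%n+o]%n≡[m+o]%n (x + c) c′ ⟩
        (x + c + c′) % n        ≡⟨ cong (_% n) (+-assoc x c c′) ⟩
        (x + (c + c′)) % n      ≡⟨ cong (λ y → (x + y) % n) c+c′≡c*n ⟩
        (x + c * n) % n         ≡⟨ [m+kn]%n≡m%n x c n ⟩
        x % n                   ≡⟨ m<n⇒m%n≡m x<n ⟩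
        x                       ∎

  [c+a]%n≡[c+b]%n⇒a≡b : ∀ {a b} c → a < n → b < n → (c + a) % n ≡ (c + b) % n → a ≡ b
  [c+a]%n≡[c+b]%n⇒a≡b {a} {b} c a<n b<n eq = [a+c]%n≡[b+c]%n⇒a≡b c a<n b<n
    (trans (cong (_% n) (+-comm a c)) (trans eq (cong (_% n) (+-comm c b))))

[1+m]%n-cases : ∀ a n → suc a % suc n ≡ suc (a % suc n) ⊎ (suc a % suc n ≡ 0 × a % suc n ≡ n)
[1+m]%n-cases a n with suc a % suc n ≟ 0
... | yes wraps = inj₂ (wraps , %-pred-≡0 wraps)
... | no ¬wraps = inj₁ (trans (sym reduce) (m<n⇒m%n≡m (≤∧≢⇒< (m%n<n a (suc n)) no-overflow)))
  where
    reduce : suc (a % suc n) % suc n ≡ suc a % suc n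
    reduce = trans (cong (_% suc n) (+-comm 1 (a % suc n)))
               (trans ([m%n+o]%n≡[m+o]%n (suc n) a 1) (cong (_% suc n) (+-comm a 1)))
    no-overflow : suc (a % suc n) ≢ suc n
    no-overflow eq = ¬wraps (trans (sym reduce) (trans (cong (_% suc n) eq) (n%n≡0 (suc n))))

Δ-tabulate : ∀ {m} (g h : Fin (suc m) → ℕ) → (∀ (k : Fin m) → g (inject₁ k) ∸ 1 ≡ h (inject₁ k) ∸ 1) →
             Δ (tabulate g) ≡ Δ (tabulate h)
Δ-tabulate {zero}  g h eq = refl
Δ-tabulate {suc m} g h eq =
  cong₂ _∷_ (eq fzero) (Δ-tabulate (λ k → g (fsuc k)) (λ k → h (fsuc k)) (λ k → eq (fsuc k)))

Δ-map-allFin : ∀ {m} (g h : Fin (suc m) → ℕ) → (∀ (k : Fin m) → g (inject₁ k) ∸ 1 ≡ h (inject₁ k) ∸ 1) →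
               Δ (map g (allFin (suc m))) ≡ Δ (map h (allFin (suc m)))
Δ-map-allFin g h eq = begin
  Δ (map g (allFin _)) ≡⟨ cong Δ (map-tabulate (λ k → k) g) ⟩
  Δ (tabulate g)       ≡⟨ Δ-tabulate g h eq ⟩
  Δ (tabulate h)       ≡⟨ cong Δ (map-tabulate (λ k → k) h) ⟨
  Δ (map h (allFin _)) ∎
  where open ≡-Reasoning

module Prime {m : ℕ} (σ : Permutation′ (suc m)) where
  open Orbit σ

  rank-one : S'' σ → rank σ fzero ≡ m
  rank-one σn≡1 = suc-injective (rank-maximum one-maximal)
    where
      n-max : val (fromℕ m) ≡ M (fromℕ m)
      n-max = ≤-antisym (val≤M _) (subst (M (fromℕ m) ≤_) (cong suc (sym (toℕ-fromℕ m))) (M≤n _))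
      M1≡Mn : M fzero ≡ M (fromℕ m)
      M1≡Mn = trans (cong M (sym σn≡1)) (M-step (fromℕ m))
      one-maximal : ∀ x → ¬ Π fzero <ₗₑₓ Π x
      one-maximal x (inj₁ M1<Mx) =
        <⇒≱ M1<Mx (subst (M x ≤_) (trans n-max (sym M1≡Mn))
                    (subst (M x ≤_) (cong suc (sym (toℕ-fromℕ m))) (M≤n x)))
      one-maximal x (inj₂ (M1≡Mx , Q1<Qx)) =
        <⇒≱ Q1<Qx (subst (Q x ≤_) (cong Q σn≡1) (Q-≤-of-max n-max (trans (sym M1≡Mx) M1≡Mn)))

  shift : ℕ
  shift = rank σ (fromℕ m)

  prime-rank : ∀ p → rank σ (prime σ p) ≡ (toℕ p + shift) % suc m
  prime-rank p = trans (hat-rank ((toℕ p + shift) mod suc m)) (toℕ-mod (toℕ p + shift) (suc m))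

  prime-injective : Injective _≡_ _≡_ (prime σ)
  prime-injective {p} {p′} eq = toℕ-injective ([a+c]%n≡[b+c]%n⇒a≡b (suc m) _ (toℕ<n p) (toℕ<n p′)
    (trans (sym (prime-rank p)) (trans (cong (rank σ) eq) (prime-rank p′))))

  prime-zero : prime σ fzero ≡ fromℕ m
  prime-zero = hat-unique {fromℕ m} {shift mod suc m}
    (sym (trans (toℕ-mod shift (suc m)) (m<n⇒m%n≡m (rank-< (fromℕ m)))))

  -- j ⋖ k: j comes right before k when σ̂ is read cyclically, provided 1 is its last letter.
  _⋖_ : Fin (suc m) → Fin (suc m) → Set
  j ⋖ k = rank σ k ≡ suc (rank σ j) ⊎ (rank σ k ≡ 0 × j ≡ fzero)

  prime-⋖ : S'' σ → ∀ (p : Fin m) → prime σ (inject₁ p) ⋖ prime σ (fsuc p)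
  prime-⋖ σ∈S'' p = from-cases ([1+m]%n-cases (toℕ p + shift) m)
    where
      before : rank σ (prime σ (inject₁ p)) ≡ (toℕ p + shift) % suc m
      before = trans (prime-rank (inject₁ p)) (cong (λ x → (x + shift) % suc m) (toℕ-inject₁ p))
      from-cases : suc (toℕ p + shift) % suc m ≡ suc ((toℕ p + shift) % suc m) ⊎
                   (suc (toℕ p + shift) % suc m ≡ 0 × (toℕ p + shift) % suc m ≡ m) →
                   prime σ (inject₁ p) ⋖ prime σ (fsuc p)
      from-cases (inj₁ next) = inj₁ (trans (prime-rank (fsuc p)) (trans next (cong suc (sym before))))
      from-cases (inj₂ (wraps , last)) = inj₂ (trans (prime-rank (fsuc p)) wraps ,
        rank-injective {prime σ (inject₁ p)} {fzero} (trans before (trans last (sym (rank-one σ∈S'')))))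

  ⋖-non-max : ∀ {j k} → j ⋖ k → val k ≢ M k → j ≡ σ ⟨$⟩ʳ k
  ⋖-non-max {j} {k} (inj₁ consecutive) not-max =
    rank-injective {j} {σ ⟨$⟩ʳ k} (suc-injective (trans (sym consecutive) (rank-step not-max)))
  ⋖-non-max {j} {k} (inj₂ (wraps , _)) not-max = ⊥-elim (0≢1+n (trans (sym wraps) (rank-step not-max)))

  ⋖-max : ∀ {j k} → j ⋖ k → val k ≡ M k → val j ≤ val k
  ⋖-max {j} {k} (inj₁ consecutive) k-max =
    subst (val j ≤_) (sym k-max)
      (val-≤-M-of-rank {j} {k} (≤-trans (n≤1+n _) (≤-reflexive (sym consecutive))))
  ⋖-max {j} {k} (inj₂ (_ , j≡1)) k-max = subst (λ x → val x ≤ val k) (sym j≡1) (s≤s z≤n)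

  image-of-max : ∀ {k} → val k ≡ M k → val (σ ⟨$⟩ʳ k) ≤ val k
  image-of-max {k} k-max = subst (val (σ ⟨$⟩ʳ k) ≤_) (trans (M-step k) (sym k-max)) (val≤M (σ ⟨$⟩ʳ k))

  Δ-entry-⋖ : ∀ {j k} → j ⋖ k → val (σ ⟨$⟩ʳ k) ∸ toℕ k ∸ 1 ≡ val j ∸ toℕ k ∸ 1
  Δ-entry-⋖ {j} {k} j⋖k = by-max (val k ≟ M k)
    where
      by-max : Dec (val k ≡ M k) → val (σ ⟨$⟩ʳ k) ∸ toℕ k ∸ 1 ≡ val j ∸ toℕ k ∸ 1
      by-max (no not-max) = cong (λ x → val x ∸ toℕ k ∸ 1) (sym (⋖-non-max j⋖k not-max))
      by-max (yes k-max)  =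
        trans (m≤1+n⇒m∸n∸1≡0 (image-of-max k-max)) (sym (m≤1+n⇒m∸n∸1≡0 (⋖-max j⋖k k-max)))

module Image {m : ℕ} (σ : Permutation′ (suc m)) (σ∈S'' : S'' σ) where
  open Orbit σ
  open Prime σ

  σ′ : Permutation′ (suc m)
  σ′ = injective⇒permutation (prime σ) prime-injective

  σ′-apply : ∀ p → σ′ ⟨$⟩ʳ p ≡ prime σ p
  σ′-apply = injective⇒permutation-apply (prime σ) prime-injective

  σ′∈S' : S' σ′
  σ′∈S' = trans (σ′-apply fzero) prime-zero

  Δ-entry : ∀ (k : Fin m) → val (σ ⟨$⟩ʳ inject₁ k) ∸ toℕ (inject₁ k) ∸ 1 ≡
                            valBefore σ′ (σ′ ⟨$⟩ˡ inject₁ k) ∸ toℕ (inject₁ k) ∸ 1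
  Δ-entry k = at-position (σ′ ⟨$⟩ˡ inject₁ k) (inverseʳ σ′)
    where
      at-position : ∀ p → σ′ ⟨$⟩ʳ p ≡ inject₁ k →
                    val (σ ⟨$⟩ʳ inject₁ k) ∸ toℕ (inject₁ k) ∸ 1 ≡ valBefore σ′ p ∸ toℕ (inject₁ k) ∸ 1
      at-position fzero    σ′0≡k = ⊥-elim (fromℕ≢inject₁ (trans (sym σ′∈S') σ′0≡k))
      at-position (fsuc p) σ′p≡k = Δ-entry-⋖ (subst₂ _⋖_ (sym (σ′-apply (inject₁ p)))
        (trans (sym (σ′-apply (fsuc p))) σ′p≡k) (prime-⋖ σ∈S'' p))

  ΔE≡ΔD : Δ (E σ) ≡ Δ (D σ′)
  ΔE≡ΔD = Δ-map-allFin _ _ Δ-entry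

-- A permutation is determined by its ranks

M-≤-of-same-rank : ∀ {n} (σ τ : Permutation′ n) → (∀ y → rank σ y ≡ rank τ y) →
                   ∀ x → Orbit.M σ x ≤ Orbit.M τ x
M-≤-of-same-rank σ τ same-rank x with y , ry≤rx , vy≡M ← Orbit.M-witness σ x =
  subst (_≤ Orbit.M τ x) vy≡M (Orbit.val-≤-M-of-rank τ (subst₂ _≤_ (same-rank y) (same-rank x) ry≤rx))

module _ {n} (σ τ : Permutation′ n) (same-rank : ∀ x → rank σ x ≡ rank τ x) where
  private
    module σ = Orbit σ
    module τ = Orbit τ

  same-M : ∀ x → σ.M x ≡ τ.M x
  same-M x =
    ≤-antisym (M-≤-of-same-rank σ τ same-rank x) (M-≤-of-same-rank τ σ (λ y → sym (same-rank y)) x)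

  rank-determines : ∀ k → σ ⟨$⟩ʳ k ≡ τ ⟨$⟩ʳ k
  rank-determines k with val k ≟ σ.M k
  ... | no not-max = σ.rank-injective (suc-injective (begin
    suc (rank σ (σ ⟨$⟩ʳ k)) ≡⟨ σ.rank-step not-max ⟨
    rank σ k                ≡⟨ same-rank k ⟩
    rank τ k                ≡⟨ τ.rank-step (λ k-max → not-max (trans k-max (sym (same-M k)))) ⟩
    suc (rank τ (τ ⟨$⟩ʳ k)) ≡⟨ cong suc (same-rank (τ ⟨$⟩ʳ k)) ⟨
    suc (rank σ (τ ⟨$⟩ʳ k)) ∎))
    where open ≡-Reasoning
  ... | yes k-max = σ.rank-injective (≤-antisym
    (subst₂ _≤_ (sym (same-rank _)) (sym (same-rank _))
      (τ.rank-≤-of-max (trans k-max (same-M k)) (trans (sym (same-M _)) (trans (σ.M-step k) (same-M k)))))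
    (σ.rank-≤-of-max k-max (trans (same-M _) (trans (τ.M-step k) (sym (same-M k))))))

prime-injective-on-S'' : ∀ {m} (σ τ : Permutation′ (suc m)) → S'' σ → S'' τ →
                         (∀ i → prime σ i ≡ prime τ i) → ∀ i → σ ⟨$⟩ʳ i ≡ τ ⟨$⟩ʳ i
prime-injective-on-S'' {m} σ τ σ∈S'' τ∈S'' same-prime = rank-determines σ τ same-rank
  where
    module σ = Prime σ
    module τ = Prime τ
    open ≡-Reasoning

    τ-rank : ∀ p → rank τ (prime σ p) ≡ (toℕ p + τ.shift) % suc m
    τ-rank p = trans (cong (rank τ) (same-prime p)) (τ.prime-rank p)

    preimage : ∀ x → ∃ λ p → prime σ p ≡ x
    preimage = injective⇒surjective (prime σ) σ.prime-injective

    same-shift : σ.shift ≡ τ.shift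
    same-shift = from-preimage (preimage fzero)
      where
        from-preimage : (∃ λ p → prime σ p ≡ fzero) → σ.shift ≡ τ.shift
        from-preimage (p₁ , σp₁≡1) =
          [c+a]%n≡[c+b]%n⇒a≡b (suc m) (toℕ p₁) (Orbit.rank-< σ (fromℕ m)) (Orbit.rank-< τ (fromℕ m))
          (begin
            (toℕ p₁ + σ.shift) % suc m ≡⟨ σ.prime-rank p₁ ⟨
            rank σ (prime σ p₁)        ≡⟨ cong (rank σ) σp₁≡1 ⟩
            rank σ fzero               ≡⟨ σ.rank-one σ∈S'' ⟩
            m                          ≡⟨ τ.rank-one τ∈S'' ⟨
            rank τ fzero               ≡⟨ cong (rank τ) σp₁≡1 ⟨
            rank τ (prime σ p₁)        ≡⟨ τ-rank p₁ ⟩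
            (toℕ p₁ + τ.shift) % suc m ∎)

    same-rank : ∀ x → rank σ x ≡ rank τ x
    same-rank x = from-preimage (preimage x)
      where
        from-preimage : (∃ λ p → prime σ p ≡ x) → rank σ x ≡ rank τ x
        from-preimage (p , σp≡x) = begin
          rank σ x                  ≡⟨ cong (rank σ) σp≡x ⟨
          rank σ (prime σ p)        ≡⟨ σ.prime-rank p ⟩
          (toℕ p + σ.shift) % suc m ≡⟨ cong (λ r → (toℕ p + r) % suc m) same-shift ⟩
          (toℕ p + τ.shift) % suc m ≡⟨ τ-rank p ⟨
          rank τ (prime σ p)        ≡⟨ cong (rank τ) σp≡x ⟩
          rank τ x                  ∎

-- Surjectivity: the cycles of a word

module _ {m : ℕ} (g : ℕ → ℕ) (g-increasing : ∀ {a b} → a < b → b ≤ m → g a < g b) where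

  increasing-gap : ∀ q d → q + d ≤ m → g q + d ≤ g (q + d)
  increasing-gap q zero    _       = ≤-reflexive (trans (+-identityʳ (g q)) (cong g (sym (+-identityʳ q))))
  increasing-gap q (suc d) q+d<m = begin
    g q + suc d     ≡⟨ +-suc (g q) d ⟩
    suc (g q + d)   ≤⟨ s≤s (increasing-gap q d (≤-trans (n≤1+n _) (subst (_≤ m) (+-suc q d) q+d<m))) ⟩
    suc (g (q + d)) ≤⟨ g-increasing (subst (q + d <_) (sym (+-suc q d)) ≤-refl) q+d<m ⟩
    g (q + suc d)   ∎
    where open ≤-Reasoning

  increasing⇒id : (∀ {a} → a ≤ m → g a ≤ m) → ∀ {q} → q ≤ m → g q ≡ q
  increasing⇒id g-bounded {q} q≤m = ≤-antisym upper lower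
    where
      lower : q ≤ g q
      lower = ≤-trans (m≤n+m q (g 0)) (increasing-gap 0 q q≤m)
      d = m ∸ q
      upper : g q ≤ q
      upper = +-cancelʳ-≤ d (g q) q (begin
        g q + d       ≤⟨ increasing-gap q d (≤-reflexive (m+[n∸m]≡n q≤m)) ⟩
        g (q + d)     ≤⟨ g-bounded (≤-reflexive (m+[n∸m]≡n q≤m)) ⟩
        m             ≡⟨ m+[n∸m]≡n q≤m ⟨
        q + d         ∎)
        where open ≤-Reasoning

-- The word has letters w 0, …, w m. It is cut before each left-to-right maximum, leader q being
-- the start of the block containing position q, and σ runs through every block backwards:
-- σ⁻¹ sends a letter to the next one of its block, and the last letter of a block to its first.
module Cycles {m : ℕ} (w : ℕ → Fin (suc m))
              (w-injective : ∀ {a b} → a ≤ m → b ≤ m → w a ≡ w b → a ≡ b) where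

  ℓ : ℕ → ℕ
  ℓ q = toℕ (w q)

  ℓ-injective : ∀ {a b} → a ≤ m → b ≤ m → ℓ a ≡ ℓ b → a ≡ b
  ℓ-injective a≤m b≤m eq = w-injective a≤m b≤m (toℕ-injective eq)

  leader : ℕ → ℕ
  leader zero = zero
  leader (suc q) with ℓ (leader q) <? ℓ (suc q)
  ... | yes _ = suc q
  ... | no  _ = leader q

  leader-≤ : ∀ q → leader q ≤ q
  leader-≤ zero = z≤n
  leader-≤ (suc q) with ℓ (leader q) <? ℓ (suc q)
  ... | yes _ = ≤-refl
  ... | no  _ = m≤n⇒m≤1+n (leader-≤ q)

  leader-max : ∀ {x q} → x ≤ q → ℓ x ≤ ℓ (leader q)
  leader-max {q = zero} z≤n = ≤-refl
  leader-max {q = suc q} x≤1+q with ℓ (leader q) <? ℓ (suc q) | m≤n⇒m<n∨m≡n x≤1+q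
  ... | yes new | inj₁ x≤q  = ≤-trans (leader-max (s≤s⁻¹ x≤q)) (<⇒≤ new)
  ... | yes _   | inj₂ refl = ≤-refl
  ... | no  _   | inj₁ x≤q  = leader-max (s≤s⁻¹ x≤q)
  ... | no  old | inj₂ refl = ≮⇒≥ old

  leader-unique : ∀ {q y} → q ≤ m → y ≤ q → (∀ {x} → x ≤ q → ℓ x ≤ ℓ y) → leader q ≡ y
  leader-unique {q} q≤m y≤q y-max = ℓ-injective (≤-trans (leader-≤ q) q≤m) (≤-trans y≤q q≤m)
    (≤-antisym (y-max (leader-≤ q)) (leader-max y≤q))

  leader-between : ∀ {q x} → q ≤ m → leader q ≤ x → x ≤ q → leader x ≡ leader q
  leader-between q≤m Lq≤x x≤q = leader-unique (≤-trans x≤q q≤m) Lq≤x (λ z≤x → leader-max (≤-trans z≤x x≤q))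

  leader-mono : ∀ {a b} → a ≤ b → b ≤ m → leader a ≤ leader b
  leader-mono {a} {b} a≤b b≤m = ≮⇒≥ λ Lb<La → <-irrefl (ℓ-injective
    (≤-trans (leader-≤ b) b≤m) (≤-trans (leader-≤ a) (≤-trans a≤b b≤m))
    (≤-antisym (leader-max (≤-trans (<⇒≤ Lb<La) (leader-≤ a))) (leader-max (≤-trans (leader-≤ a) a≤b))))
    Lb<La

  leader-ℓ-< : ∀ {a b} → leader a < leader b → b ≤ m → ℓ (leader a) < ℓ (leader b)
  leader-ℓ-< {a} {b} La<Lb b≤m = ≤∧≢⇒< (leader-max La≤b)
    (λ eq → <-irrefl (ℓ-injective (≤-trans La≤b b≤m) (≤-trans (leader-≤ b) b≤m) eq) La<Lb)
    where La≤b = ≤-trans (<⇒≤ La<Lb) (leader-≤ b)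

  next : ℕ → ℕ
  next q with suc q ≤? m | ℓ (leader q) <? ℓ (suc q)
  ... | yes _ | no  _ = suc q
  ... | yes _ | yes _ = leader q
  ... | no  _ | _     = leader q

  Continues EndsBlock : ℕ → Set
  Continues q = suc q ≤ m × ¬ ℓ (leader q) < ℓ (suc q)
  EndsBlock q = suc q ≤ m → ℓ (leader q) < ℓ (suc q)

  next-cases : ∀ q → (Continues q × next q ≡ suc q) ⊎ (EndsBlock q × next q ≡ leader q)
  next-cases q with suc q ≤? m | ℓ (leader q) <? ℓ (suc q)
  ... | yes inside | no  old = inj₁ ((inside , old) , refl)
  ... | yes _      | yes new = inj₂ ((λ _ → new) , refl)
  ... | no  beyond | _       = inj₂ ((λ inside → ⊥-elim (beyond inside)) , refl)

  leader-suc-old : ∀ {q} → ¬ ℓ (leader q) < ℓ (suc q) → leader (suc q) ≡ leader q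
  leader-suc-old {q} old with ℓ (leader q) <? ℓ (suc q)
  ... | yes new = ⊥-elim (old new)
  ... | no  _   = refl

  leader-suc-new : ∀ {q} → ℓ (leader q) < ℓ (suc q) → leader (suc q) ≡ suc q
  leader-suc-new {q} new with ℓ (leader q) <? ℓ (suc q)
  ... | yes _   = refl
  ... | no  old = ⊥-elim (old new)

  next-≤ : ∀ {q} → q ≤ m → next q ≤ m
  next-≤ {q} q≤m with next-cases q
  ... | inj₁ ((inside , _) , eq) = subst (_≤ m) (sym eq) inside
  ... | inj₂ (_ , eq)            = subst (_≤ m) (sym eq) (≤-trans (leader-≤ q) q≤m)

  leader-next : ∀ {q} → q ≤ m → leader (next q) ≡ leader q
  leader-next {q} q≤m with next-cases q
  ... | inj₁ ((_ , old) , eq) = trans (cong leader eq) (leader-suc-old old)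
  ... | inj₂ (_ , eq)         = trans (cong leader eq) (leader-between q≤m ≤-refl (leader-≤ q))

  continuation-not-leader : ∀ {a b} → a ≤ m → b ≤ m → Continues a → suc a ≢ leader b
  continuation-not-leader {a} {b} a≤m b≤m (_ , old) 1+a≡Lb = <-irrefl La≡1+a (s≤s (leader-≤ a))
    where
      1+a≤b = subst (_≤ b) (sym 1+a≡Lb) (leader-≤ b)
      La≡1+a = ℓ-injective (≤-trans (leader-≤ a) a≤m) (≤-trans 1+a≤b b≤m) (≤-antisym
        (subst (ℓ (leader a) ≤_) (cong ℓ (sym 1+a≡Lb))
          (leader-max (≤-trans (leader-≤ a) (≤-trans (n≤1+n a) 1+a≤b))))
        (≮⇒≥ old))

  block-ends-distinct : ∀ {a b} → a < b → b ≤ m → EndsBlock a → leader a ≢ leader b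
  block-ends-distinct {a} {b} a<b b≤m end-a La≡Lb =
    <⇒≱ (end-a (≤-trans a<b b≤m)) (subst (ℓ (suc a) ≤_) (cong ℓ (sym La≡Lb)) (leader-max a<b))

  next-injective : ∀ {a b} → a ≤ m → b ≤ m → next a ≡ next b → a ≡ b
  next-injective {a} {b} a≤m b≤m eq with next-cases a | next-cases b
  ... | inj₁ (_ , na)     | inj₁ (_ , nb)     = suc-injective (trans (sym na) (trans eq nb))
  ... | inj₁ (cont-a , na) | inj₂ (_ , nb)     =
    ⊥-elim (continuation-not-leader a≤m b≤m cont-a (trans (sym na) (trans eq nb)))
  ... | inj₂ (_ , na)     | inj₁ (cont-b , nb) =
    ⊥-elim (continuation-not-leader b≤m a≤m cont-b (trans (sym nb) (trans (sym eq) na)))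
  ... | inj₂ (end-a , na) | inj₂ (end-b , nb) with <-cmp a b
  ...   | tri< a<b _ _ = ⊥-elim (block-ends-distinct a<b b≤m end-a (trans (sym na) (trans eq nb)))
  ...   | tri≈ _ a≡b _ = a≡b
  ...   | tri> _ _ b<a = ⊥-elim (block-ends-distinct b<a a≤m end-b (trans (sym nb) (trans (sym eq) na)))

  next-after-follower : ∀ {q} → suc q ≤ m → leader (suc q) ≢ suc q → next q ≡ suc q
  next-after-follower {q} inside follower with next-cases q
  ... | inj₁ (_ , eq)   = eq
  ... | inj₂ (end , _)  = ⊥-elim (follower (leader-suc-new (end inside)))

  next-last : next m ≡ leader m
  next-last with next-cases m
  ... | inj₁ ((beyond , _) , _) = ⊥-elim (<-irrefl refl beyond)
  ... | inj₂ (_ , eq)           = eq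

  wᶠ-injective : Injective _≡_ _≡_ (λ (i : Fin (suc m)) → w (toℕ i))
  wᶠ-injective {i} {j} eq = toℕ-injective (w-injective (s≤s⁻¹ (toℕ<n i)) (s≤s⁻¹ (toℕ<n j)) eq)

  located : ∀ k → ∃ λ (i : Fin (suc m)) → w (toℕ i) ≡ k
  located = injective⇒surjective (λ i → w (toℕ i)) wᶠ-injective

  position : Fin (suc m) → ℕ
  position k = toℕ (proj₁ (located k))

  position-≤ : ∀ k → position k ≤ m
  position-≤ k = s≤s⁻¹ (toℕ<n (proj₁ (located k)))

  w-position : ∀ k → w (position k) ≡ k
  w-position k = proj₂ (located k)

  position-w : ∀ {q} → q ≤ m → position (w q) ≡ q
  position-w q≤m = w-injective (position-≤ _) q≤m (w-position _)

  σ⁻¹ : Fin (suc m) → Fin (suc m)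
  σ⁻¹ k = w (next (position k))

  σ⁻¹-injective : Injective _≡_ _≡_ σ⁻¹
  σ⁻¹-injective {j} {k} eq = trans (sym (w-position j)) (trans
    (cong w (next-injective (position-≤ j) (position-≤ k)
      (w-injective (next-≤ (position-≤ j)) (next-≤ (position-≤ k)) eq)))
    (w-position k))

  σ⁻¹-w : ∀ {q} → q ≤ m → σ⁻¹ (w q) ≡ w (next q)
  σ⁻¹-w q≤m = cong (λ p → w (next p)) (position-w q≤m)

  σ : Permutation′ (suc m)
  σ = flip (injective⇒permutation σ⁻¹ σ⁻¹-injective)

  σ-σ⁻¹ : ∀ x → σ ⟨$⟩ʳ σ⁻¹ x ≡ x
  σ-σ⁻¹ x =
    trans (cong (σ ⟨$⟩ʳ_) (sym (injective⇒permutation-apply σ⁻¹ σ⁻¹-injective x))) (inverseʳ σ)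

  σ⁻¹-σ : ∀ x → σ⁻¹ (σ ⟨$⟩ʳ x) ≡ x
  σ⁻¹-σ x = trans (sym (injective⇒permutation-apply σ⁻¹ σ⁻¹-injective _)) (inverseˡ σ)

  σ-down : ∀ {q} → suc q ≤ m → leader (suc q) ≢ suc q → σ ⟨$⟩ʳ w (suc q) ≡ w q
  σ-down {q} inside follower = begin
    σ ⟨$⟩ʳ w (suc q)      ≡⟨ cong (σ ⟨$⟩ʳ_) σ⁻¹-wq ⟨
    σ ⟨$⟩ʳ σ⁻¹ (w q)      ≡⟨ σ-σ⁻¹ (w q) ⟩
    w q                   ∎
    where
      open ≡-Reasoning
      σ⁻¹-wq : σ⁻¹ (w q) ≡ w (suc q)
      σ⁻¹-wq = trans (σ⁻¹-w (≤-trans (n≤1+n q) inside)) (cong w (next-after-follower inside follower))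

  σ-wraps : σ ⟨$⟩ʳ w (leader m) ≡ w m
  σ-wraps = begin
    σ ⟨$⟩ʳ w (leader m)   ≡⟨ cong (σ ⟨$⟩ʳ_) (trans (σ⁻¹-w ≤-refl) (cong w next-last)) ⟨
    σ ⟨$⟩ʳ σ⁻¹ (w m)      ≡⟨ σ-σ⁻¹ (w m) ⟩
    w m                   ∎
    where open ≡-Reasoning

  InBlock : ℕ → Fin (suc m) → Set
  InBlock q y = ∃ λ x → x ≤ m × leader x ≡ leader q × y ≡ w x

  σ-within-block : ∀ {q} → q ≤ m → InBlock q (σ ⟨$⟩ʳ w q)
  σ-within-block {q} q≤m =
    x , position-≤ _ , trans (sym (leader-next (position-≤ _))) (cong leader next-x≡q) , sym (w-position _)
    where
      x = position (σ ⟨$⟩ʳ w q)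
      next-x≡q : next x ≡ q
      next-x≡q = w-injective (next-≤ (position-≤ _)) q≤m (trans (sym (σ⁻¹-w (position-≤ _)))
        (trans (cong σ⁻¹ (w-position _)) (σ⁻¹-σ (w q))))

  σ-preserves-block : ∀ {q y} → InBlock q y → InBlock q (σ ⟨$⟩ʳ y)
  σ-preserves-block {q} (x , x≤m , Lx≡Lq , refl) = change-leader (σ-within-block x≤m)
    where
      change-leader : InBlock x (σ ⟨$⟩ʳ w x) → InBlock q (σ ⟨$⟩ʳ w x)
      change-leader (z , z≤m , Lz≡Lx , eq) = z , z≤m , trans Lz≡Lx Lx≡Lq , eq

  open Orbit σ

  iterate-within-block : ∀ p {q} → q ≤ m → InBlock q (σ^ p (w q))
  iterate-within-block zero    {q} q≤m = q , q≤m , refl , refl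
  iterate-within-block (suc p) {q} q≤m = σ-preserves-block {q} (iterate-within-block p q≤m)

  iterate-down : ∀ j {q} → q ≤ m → j ≤ q ∸ leader q → σ^ j (w q) ≡ w (q ∸ j)
  iterate-down zero    q≤m _ = refl
  iterate-down (suc j) {q} q≤m 1+j≤ = begin
    σ ⟨$⟩ʳ σ^ j (w q)              ≡⟨ cong (σ ⟨$⟩ʳ_) (iterate-down j q≤m (≤-trans (n≤1+n j) 1+j≤)) ⟩
    σ ⟨$⟩ʳ w (q ∸ j)               ≡⟨ cong (λ x → σ ⟨$⟩ʳ w x) q∸j≡1+q∸[1+j] ⟩
    σ ⟨$⟩ʳ w (suc (q ∸ suc j))     ≡⟨ σ-down (subst (_≤ m) q∸j≡1+q∸[1+j] (≤-trans (m∸n≤m q j) q≤m)) follower ⟩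
    w (q ∸ suc j)                  ∎
    where
      open ≡-Reasoning
      Lq<q∸j : leader q < q ∸ j
      Lq<q∸j = m<n∸o⇒o<n∸m 1+j≤ (leader-≤ q)
      q∸j≡1+q∸[1+j] : q ∸ j ≡ suc (q ∸ suc j)
      q∸j≡1+q∸[1+j] = trans (sym (suc-pred (q ∸ j) {{>-nonZero (≤-<-trans z≤n Lq<q∸j)}}))
                            (cong suc (pred[m∸n]≡m∸[1+n] q j))
      follower : leader (suc (q ∸ suc j)) ≢ suc (q ∸ suc j)
      follower eq = <-irrefl (trans (sym (leader-between q≤m (<⇒≤ Lq<q∸j) (m∸n≤m q j)))
        (trans (cong leader q∸j≡1+q∸[1+j]) (trans eq (sym q∸j≡1+q∸[1+j])))) Lq<q∸j

  reaches-leader : ∀ {q} → q ≤ m → σ^ (q ∸ leader q) (w q) ≡ w (leader q)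
  reaches-leader {q} q≤m = trans (iterate-down (q ∸ leader q) q≤m ≤-refl) (cong w (m∸[m∸n]≡n (leader-≤ q)))

  M-at : ∀ {q} → q ≤ m → M (w q) ≡ suc (ℓ (leader q))
  M-at {q} q≤m = M-unique {w q} {suc (ℓ (leader q))} bound (q ∸ leader q) reached
    where
      bound : ∀ p → val (σ^ p (w q)) ≤ suc (ℓ (leader q))
      bound p = within (iterate-within-block p q≤m)
        where
          within : InBlock q (σ^ p (w q)) → val (σ^ p (w q)) ≤ suc (ℓ (leader q))
          within (x , _ , Lx≡Lq , eq) = subst (λ y → val y ≤ suc (ℓ (leader q))) (sym eq)
            (s≤s (subst (λ L → ℓ x ≤ ℓ L) Lx≡Lq (leader-max ≤-refl)))
      reached : val (σ^ (q ∸ leader q) (w q)) ≡ suc (ℓ (leader q))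
      reached = cong val (reaches-leader q≤m)

  Q-at : ∀ {q} → q ≤ m → Q (w q) ≡ q ∸ leader q
  Q-at {q} q≤m =
    Q-unique {w q} {q ∸ leader q} (trans (cong val (reaches-leader q≤m)) (sym (M-at q≤m)) , below)
    where
      below : ∀ {j} → j < q ∸ leader q → val (σ^ j (w q)) ≢ M (w q)
      below {j} j< eq = <-irrefl (sym (ℓ-injective (≤-trans (m∸n≤m q j) q≤m) (≤-trans (leader-≤ q) q≤m)
        (suc-injective (trans (cong val (sym (iterate-down j q≤m (<⇒≤ j<)))) (trans eq (M-at q≤m))))))
        (m<n∸o⇒o<n∸m j< (leader-≤ q))

  Π-at : ∀ {q} → q ≤ m → Π (w q) ≡ (suc (ℓ (leader q)) , q ∸ leader q)
  Π-at q≤m = cong₂ _,_ (M-at q≤m) (Q-at q≤m)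

  Π-increasing : ∀ {a b} → a < b → b ≤ m → Π (w a) <ₗₑₓ Π (w b)
  Π-increasing {a} {b} a<b b≤m = subst₂ _<ₗₑₓ_ (sym (Π-at (≤-trans (<⇒≤ a<b) b≤m))) (sym (Π-at b≤m))
    (by-leaders (m≤n⇒m<n∨m≡n (leader-mono (<⇒≤ a<b) b≤m)))
    where
      by-leaders : leader a < leader b ⊎ leader a ≡ leader b →
                   (suc (ℓ (leader a)) , a ∸ leader a) <ₗₑₓ (suc (ℓ (leader b)) , b ∸ leader b)
      by-leaders (inj₁ La<Lb) = inj₁ (s≤s (leader-ℓ-< {a} {b} La<Lb b≤m))
      by-leaders (inj₂ La≡Lb) = inj₂ (cong (λ L → suc (ℓ L)) La≡Lb ,
        subst (λ L → a ∸ leader a < b ∸ L) La≡Lb (∸-monoˡ-< a<b (leader-≤ a)))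

  rank-w : ∀ {q} → q ≤ m → rank σ (w q) ≡ q
  rank-w = increasing⇒id {m} (λ q → rank σ (w q))
    (λ {a} {b} a<b b≤m → rank-mono {w a} {w b} (Π-increasing a<b b≤m)) (λ {a} _ → s≤s⁻¹ (rank-< (w a)))

  hat-w : ∀ i → hat σ i ≡ w (toℕ i)
  hat-w i = hat-unique {w (toℕ i)} {i} (rank-w (s≤s⁻¹ (toℕ<n i)))

-- word is π rotated to end with the letter 1, which sits at position p₁ of π; since π starts with
-- n, the letter n then sits at position top of word.
module Preimage {m : ℕ} (π : Permutation′ (suc m)) (π∈S' : S' π) where

  p₁ : ℕ
  p₁ = toℕ (π ⟨$⟩ˡ fzero)

  p₁≤m : p₁ ≤ m
  p₁≤m = s≤s⁻¹ (toℕ<n (π ⟨$⟩ˡ fzero))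

  top : ℕ
  top = m ∸ p₁

  top+1+p₁ : top + suc p₁ ≡ suc m
  top+1+p₁ = trans (+-suc top p₁) (cong suc (m∸n+n≡m p₁≤m))

  word : ℕ → Fin (suc m)
  word q = π ⟨$⟩ʳ ((q + suc p₁) mod suc m)

  word-injective : ∀ {a b} → a ≤ m → b ≤ m → word a ≡ word b → a ≡ b
  word-injective {a} {b} a≤m b≤m eq = [a+c]%n≡[b+c]%n⇒a≡b (suc m) (suc p₁) (s≤s a≤m) (s≤s b≤m) (begin
    (a + suc p₁) % suc m         ≡⟨ toℕ-mod (a + suc p₁) (suc m) ⟨
    toℕ ((a + suc p₁) mod suc m) ≡⟨ cong toℕ (Orbit.σ-injective π eq) ⟩
    toℕ ((b + suc p₁) mod suc m) ≡⟨ toℕ-mod (b + suc p₁) (suc m) ⟩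
    (b + suc p₁) % suc m         ∎)
    where open ≡-Reasoning

  open Cycles word word-injective public
  open Prime σ using (shift)

  word-top : word top ≡ fromℕ m
  word-top = trans (cong (π ⟨$⟩ʳ_) (toℕ-injective (trans (toℕ-fromℕ< _)
    (trans (cong (_% suc m) top+1+p₁) (n%n≡0 (suc m)))))) π∈S'

  word-last : word m ≡ fzero
  word-last = trans (cong (π ⟨$⟩ʳ_) (toℕ-injective (trans (toℕ-fromℕ< _) (begin
    (m + suc p₁) % suc m ≡⟨ cong (_% suc m) (trans (+-suc m p₁) (+-comm (suc m) p₁)) ⟩
    (p₁ + suc m) % suc m ≡⟨ [m+n]%n≡m%n p₁ (suc m) ⟩
    p₁ % suc m           ≡⟨ m≤n⇒m%n≡m p₁≤m ⟩
    p₁                   ∎)))) (inverseʳ π)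
    where open ≡-Reasoning

  leader-last : leader m ≡ top
  leader-last = leader-unique {m} {top} ≤-refl (m∸n≤m m p₁)
    (λ {x} _ → subst (ℓ x ≤_) (trans (sym (toℕ-fromℕ m)) (cong toℕ (sym word-top)))
                              (s≤s⁻¹ (toℕ<n (word x))))

  σ∈S'' : S'' σ
  σ∈S'' = begin
    σ ⟨$⟩ʳ fromℕ m        ≡⟨ cong (σ ⟨$⟩ʳ_) (trans (sym word-top) (cong word (sym leader-last))) ⟩
    σ ⟨$⟩ʳ word (leader m) ≡⟨ σ-wraps ⟩
    word m                ≡⟨ word-last ⟩
    fzero                 ∎
    where open ≡-Reasoning

  shift≡top : shift ≡ top
  shift≡top = trans (cong (rank σ) (sym word-top)) (rank-w {top} (m∸n≤m m p₁))

  prime-σ : ∀ i → prime σ i ≡ π ⟨$⟩ʳ i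
  prime-σ i = begin
    hat σ ((toℕ i + shift) mod suc m)      ≡⟨ hat-w ((toℕ i + shift) mod suc m) ⟩
    word (toℕ ((toℕ i + shift) mod suc m)) ≡⟨ cong (π ⟨$⟩ʳ_) (toℕ-injective unrotate) ⟩
    π ⟨$⟩ʳ i                               ∎
    where
      open ≡-Reasoning
      unrotate : toℕ ((toℕ ((toℕ i + shift) mod suc m) + suc p₁) mod suc m) ≡ toℕ i
      unrotate = begin
        toℕ ((toℕ ((toℕ i + shift) mod suc m) + suc p₁) mod suc m)
          ≡⟨ toℕ-mod (toℕ ((toℕ i + shift) mod suc m) + suc p₁) (suc m) ⟩
        (toℕ ((toℕ i + shift) mod suc m) + suc p₁) % suc m
          ≡⟨ cong (λ x → (x + suc p₁) % suc m) (toℕ-mod (toℕ i + shift) (suc m)) ⟩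
        ((toℕ i + shift) % suc m + suc p₁) % suc m
          ≡⟨ [m%n+o]%n≡[m+o]%n (suc m) (toℕ i + shift) (suc p₁) ⟩
        (toℕ i + shift + suc p₁) % suc m
          ≡⟨ cong (_% suc m) (+-assoc (toℕ i) shift (suc p₁)) ⟩
        (toℕ i + (shift + suc p₁)) % suc m
          ≡⟨ cong (λ x → (toℕ i + (x + suc p₁)) % suc m) shift≡top ⟩
        (toℕ i + (top + suc p₁)) % suc m
          ≡⟨ cong (λ x → (toℕ i + x) % suc m) top+1+p₁ ⟩
        (toℕ i + suc m) % suc m
          ≡⟨ [m+n]%n≡m%n (toℕ i) (suc m) ⟩
        toℕ i % suc m
          ≡⟨ m<n⇒m%n≡m (toℕ<n i) ⟩
        toℕ i ∎

mainTheorem8 : (m : ℕ) →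
    ((σ : Permutation′ (suc m)) → S'' σ →
       Σ (Permutation′ (suc m)) (λ π →
         ((i : Fin (suc m)) → π ⟨$⟩ʳ i ≡ prime σ i) × S' π × Δ (E σ) ≡ Δ (D π)))
    × ((σ τ : Permutation′ (suc m)) → S'' σ → S'' τ →
       ((i : Fin (suc m)) → prime σ i ≡ prime τ i) →
       (i : Fin (suc m)) → σ ⟨$⟩ʳ i ≡ τ ⟨$⟩ʳ i)
    × ((π : Permutation′ (suc m)) → S' π →
       Σ (Permutation′ (suc m)) (λ σ →
         S'' σ × ((i : Fin (suc m)) → prime σ i ≡ π ⟨$⟩ʳ i)))
mainTheorem8 m = forward , prime-injective-on-S'' , backward
  where
    forward : (σ : Permutation′ (suc m)) → S'' σ →
              Σ (Permutation′ (suc m)) (λ π →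
                ((i : Fin (suc m)) → π ⟨$⟩ʳ i ≡ prime σ i) × S' π × Δ (E σ) ≡ Δ (D π))
    forward σ σ∈S'' = σ′ , σ′-apply , σ′∈S' , ΔE≡ΔD
      where open Image σ σ∈S''
    backward : (π : Permutation′ (suc m)) → S' π →
               Σ (Permutation′ (suc m)) (λ σ → S'' σ × ((i : Fin (suc m)) → prime σ i ≡ π ⟨$⟩ʳ i))
    backward π π∈S' = σ , σ∈S'' , prime-σ
      where open Preimage π π∈S'
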